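{- Let $G$ be a group with identity $\mathbf{1}$, $S$ an inverse-closed subset of $G$, and $X=\mathrm{Cay}(G;S)$. Let \[S^*=\{s\in S\mid \text{no nontrivial colour-preserving automorphism } \psi \text{ of } X \text{ with } \psi(\mathbf{1})=\mathbf{1} \text{ satisfies } \psi(s)=s\}.\] If $S^*$ generates $G$, then $X$ is strongly CCA.
   Context: $\mathrm{Cay}(G;S)$ has vertex set $G$ and edges $\{g,gs\}$ for $g\in G$, $s\in S$; the edge $\{g,gs\}$ is coloured $\{s,s^{ -1}\}$. A graph automorphism is colour-preserving if it maps each edge to an edge of the same colour, and colour-permuting if any two edges of the same colour are mapped to edges of a common colour. A map $G\to G$ is affine if it is of the form $x\mapsto\alpha(gx)$ with $\alpha$ a group automorphism of $G$ and $g\in G$. $X$ is strongly CCA if every colour-permuting automorphism of $X$ is affine. -}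

module Defs where

open import Level using (Level; _⊔_; suc)
open import Data.Product using (Σ; ∃; ∃-syntax; _×_; _,_)
open import Data.Sum using (_⊎_)
open import Function.Bundles using (Inverse; _⇔_)
open import Relation.Unary using (Pred)
open import Relation.Binary.Definitions using (_Respects_)
open import Algebra.Bundles using (Group)
open import Algebra.Morphism.Structures using (module GroupMorphisms)

module Cayley {c ℓ p : Level} (G : Group c ℓ) (S : Pred (Group.Carrier G) p) where
  open Group G

  InverseClosed : Set (c ⊔ p)
  InverseClosed = ∀ s → S s → S (s ⁻¹)

  Adj : Carrier → Carrier → Set (c ⊔ ℓ ⊔ p)
  Adj x y = ∃[ s ] (S s × y ≈ x ∙ s)

  -- the edge {x,y} = {x, x s} (s = x⁻¹ y) has colour {s, s⁻¹} = {x⁻¹ y, y⁻¹ x};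
  -- two edges {x,y}, {u,v} have the same colour iff {x⁻¹y, y⁻¹x} = {u⁻¹v, v⁻¹u}
  -- as sets, i.e. x⁻¹ y equals u⁻¹ v or v⁻¹ u.
  SameColour : Carrier → Carrier → Carrier → Carrier → Set ℓ
  SameColour x y u v = (x ⁻¹ ∙ y ≈ u ⁻¹ ∙ v) ⊎ (x ⁻¹ ∙ y ≈ v ⁻¹ ∙ u)

  record Automorphism : Set (c ⊔ ℓ ⊔ p) where
    field
      bij : Inverse setoid setoid
    open Inverse bij public using (to; from)
    field
      adj : ∀ x y → Adj x y ⇔ Adj (to x) (to y)

  open Automorphism public

  ColourPreserving : Automorphism → Set (c ⊔ ℓ ⊔ p)
  ColourPreserving φ =
    ∀ x y → Adj x y → SameColour x y (to φ x) (to φ y)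

  ColourPermuting : Automorphism → Set (c ⊔ ℓ ⊔ p)
  ColourPermuting φ =
    ∀ x y u v → Adj x y → Adj u v → SameColour x y u v →
      SameColour (to φ x) (to φ y) (to φ u) (to φ v)

  Trivial : Automorphism → Set (c ⊔ ℓ)
  Trivial φ = ∀ x → to φ x ≈ x

  IsGroupAutomorphism : (Carrier → Carrier) → Set (c ⊔ ℓ)
  IsGroupAutomorphism α = GroupMorphisms.IsGroupIsomorphism rawGroup rawGroup α

  Affine : (Carrier → Carrier) → Set (c ⊔ ℓ)
  Affine f = ∃[ α ] ∃[ g ] (IsGroupAutomorphism α × (∀ x → f x ≈ α (g ∙ x)))

  StronglyCCA : Set (c ⊔ ℓ ⊔ p)
  StronglyCCA = ∀ (φ : Automorphism) → ColourPermuting φ → Affine (to φ)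

  S* : Pred Carrier (c ⊔ ℓ ⊔ p)
  S* s = S s × (∀ (ψ : Automorphism) → ColourPreserving ψ →
                  to ψ ε ≈ ε → to ψ s ≈ s → Trivial ψ)

module _ {c ℓ q : Level} (G : Group c ℓ) (T : Pred (Group.Carrier G) q) where
  open Group G
  data Generated : Carrier → Set (c ⊔ ℓ ⊔ q) where
    gen  : ∀ {x} → T x → Generated x
    unit : Generated ε
    inv  : ∀ {x} → Generated x → Generated (x ⁻¹)
    mul  : ∀ {x y} → Generated x → Generated y → Generated (x ∙ y)
    resp : ∀ {x y} → x ≈ y → Generated x → Generated y

  Generates : Set (c ⊔ ℓ ⊔ q)
  Generates = ∀ x → Generated x

-- Normalise a colour-permuting automorphism φ to f = (φ 1)⁻¹ φ, which fixes 1; it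
-- suffices that f is a group automorphism. For s ∈ S* the map
-- x ↦ f⁻¹ (f s · f (s⁻¹ x)) is colour-preserving (a translation conjugated by a
-- colour-permuting automorphism preserves colours) and fixes 1 and s, hence is the
-- identity; that is, f (s y) = f s · f y. The g with f (g x) = f g · f x for all x form
-- a subgroup, which therefore is G = ⟨S*⟩.
-- Fixing 1 and s needs f (s⁻¹) = (f s)⁻¹. Colour-permutation gives this unless f
-- sends an involution q ∈ S and a non-involution to the same colour. To exclude that:
-- as S* ≠ ∅, the colour-preserving stabiliser of 1 has at most two elements, so f
-- centralises it; it contains τ : x ↦ (f q)⁻¹ · f (q · f⁻¹ x), and τ (f q) = (f q)⁻¹
-- while f τ f⁻¹ fixes f q.
module Submission where

open import Defs
open import Level using (Level; _⊔_)
open import Relation.Unary using (Pred; _⊆_)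
open import Relation.Binary.Core using (Rel)
open import Relation.Binary.Definitions using (_Respects_)
open import Algebra.Bundles using (Group)
open import Data.Product using (∃; _,_)
open import Data.Sum using (_⊎_; inj₁; inj₂)
open import Function.Bundles using (Inverse; Equivalence; Injection; Surjection; mk⇔)
open import Function.Properties.Inverse using (Inverse⇒Injection; Inverse⇒Surjection)
import Function.Construct.Composition as Composition
import Function.Construct.Symmetry as Symmetry
import Algebra.Properties.Group as GroupProperties
import Algebra.Properties.Loop as LoopProperties
import Relation.Binary.Reasoning.Setoid as SetoidReasoning

module _ {c ℓ q r : Level} (G : Group c ℓ) {T : Pred (Group.Carrier G) q} where
  open Group G

  Generated⊆ : {P : Pred Carrier r} → P Respects _≈_ → P ε →
               (∀ {x} → P x → P (x ⁻¹)) → (∀ {x y} → P x → P y → P (x ∙ y)) →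
               T ⊆ P → Generated G T ⊆ P
  Generated⊆ {P} P-resp P-ε P-⁻¹ P-∙ T⊆P = closed
    where
    closed : Generated G T ⊆ P
    closed (gen t)      = T⊆P t
    closed unit         = P-ε
    closed (inv g)      = P-⁻¹ (closed g)
    closed (mul g h)    = P-∙ (closed g) (closed h)
    closed (resp x≈y g) = P-resp x≈y (closed g)

module _ {c ℓ q : Level} (G : Group c ℓ) {T : Pred (Group.Carrier G) q} where
  open Group G
  open GroupProperties G using (ε⁻¹≈ε)

  Generated⇒inhabited⊎≈ε : ∀ {x} → Generated G T x → ∃ T ⊎ x ≈ ε
  Generated⇒inhabited⊎≈ε =
    Generated⊆ G respects (inj₂ refl) ⁻¹-closed ∙-closed (λ t → inj₁ (_ , t))
    where
    respects : ∀ {x y} → x ≈ y → ∃ T ⊎ x ≈ ε → ∃ T ⊎ y ≈ ε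
    respects _   (inj₁ t)   = inj₁ t
    respects x≈y (inj₂ x≈ε) = inj₂ (trans (sym x≈y) x≈ε)

    ⁻¹-closed : ∀ {x} → ∃ T ⊎ x ≈ ε → ∃ T ⊎ x ⁻¹ ≈ ε
    ⁻¹-closed (inj₁ t)   = inj₁ t
    ⁻¹-closed (inj₂ x≈ε) = inj₂ (trans (⁻¹-cong x≈ε) ε⁻¹≈ε)

    ∙-closed : ∀ {x y} → ∃ T ⊎ x ≈ ε → ∃ T ⊎ y ≈ ε → ∃ T ⊎ x ∙ y ≈ ε
    ∙-closed (inj₁ t)   _          = inj₁ t
    ∙-closed (inj₂ _)   (inj₁ t)   = inj₁ t
    ∙-closed (inj₂ x≈ε) (inj₂ y≈ε) = inj₂ (trans (∙-cong x≈ε y≈ε) (identityˡ ε))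

module CayleyGraph {c ℓ p : Level} (G : Group c ℓ) (S : Pred (Group.Carrier G) p) where
  open Group G
  open Cayley G S
  open GroupProperties G
  open LoopProperties loop using (ε\\x≈x)
  open SetoidReasoning setoid

  \\-invariant : ∀ a x y → (a ∙ x) \\ (a ∙ y) ≈ x \\ y
  \\-invariant a x y = begin
    (a ∙ x) ⁻¹ ∙ (a ∙ y)   ≈⟨ ∙-congʳ (⁻¹-anti-homo-∙ a x) ⟩
    x ⁻¹ ∙ a ⁻¹ ∙ (a ∙ y)  ≈⟨ assoc _ _ _ ⟩
    x ⁻¹ ∙ (a \\ (a ∙ y))  ≈⟨ ∙-congˡ (\\-leftDividesʳ a y) ⟩
    x \\ y                 ∎

  \\-identityˡ : ∀ {e} y → e ≈ ε → e \\ y ≈ y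
  \\-identityˡ y e≈ε = trans (\\-cong₂ e≈ε refl) (ε\\x≈x y)

  infix 4 _≈±_
  _≈±_ : Rel Carrier ℓ
  a ≈± b = a ≈ b ⊎ a ≈ b ⁻¹

  ≈±-sym : ∀ {a b} → a ≈± b → b ≈± a
  ≈±-sym (inj₁ a≈b)   = inj₁ (sym a≈b)
  ≈±-sym (inj₂ a≈b⁻¹) = inj₂ (trans (sym (⁻¹-involutive _)) (⁻¹-cong (sym a≈b⁻¹)))

  ≈±-trans : ∀ {a b d} → a ≈± b → b ≈± d → a ≈± d
  ≈±-trans (inj₁ a≈b)   (inj₁ b≈d)   = inj₁ (trans a≈b b≈d)
  ≈±-trans (inj₁ a≈b)   (inj₂ b≈d⁻¹) = inj₂ (trans a≈b b≈d⁻¹)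
  ≈±-trans (inj₂ a≈b⁻¹) (inj₁ b≈d)   = inj₂ (trans a≈b⁻¹ (⁻¹-cong b≈d))
  ≈±-trans (inj₂ a≈b⁻¹) (inj₂ b≈d⁻¹) =
    inj₁ (trans a≈b⁻¹ (trans (⁻¹-cong b≈d⁻¹) (⁻¹-involutive _)))

  ≈±-resp : ∀ {a a′ b b′} → a ≈ a′ → b ≈ b′ → a ≈± b → a′ ≈± b′
  ≈±-resp a≈a′ b≈b′ (inj₁ a≈b)   = inj₁ (trans (sym a≈a′) (trans a≈b b≈b′))
  ≈±-resp a≈a′ b≈b′ (inj₂ a≈b⁻¹) = inj₂ (trans (sym a≈a′) (trans a≈b⁻¹ (⁻¹-cong b≈b′)))

  SameColour⇒≈± : ∀ {x y u v} → SameColour x y u v → x \\ y ≈± u \\ v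
  SameColour⇒≈± (inj₁ e) = inj₁ e
  SameColour⇒≈± (inj₂ e) = inj₂ (trans e (sym (⁻¹-anti-homo-\\ _ _)))

  ≈±⇒SameColour : ∀ {x y u v} → x \\ y ≈± u \\ v → SameColour x y u v
  ≈±⇒SameColour (inj₁ e) = inj₁ e
  ≈±⇒SameColour (inj₂ e) = inj₂ (trans e (⁻¹-anti-homo-\\ _ _))

  SameColour-sym : ∀ {x y u v} → SameColour x y u v → SameColour u v x y
  SameColour-sym xyuv = ≈±⇒SameColour (≈±-sym (SameColour⇒≈± xyuv))

  SameColour-trans : ∀ {x y u v a b} →
                     SameColour x y u v → SameColour u v a b → SameColour x y a b
  SameColour-trans xyuv uvab = ≈±⇒SameColour (≈±-trans (SameColour⇒≈± xyuv) (SameColour⇒≈± uvab))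

  SameColour-resp : ∀ {x x′ y y′ u u′ v v′} → x ≈ x′ → y ≈ y′ → u ≈ u′ → v ≈ v′ →
                    SameColour x y u v → SameColour x′ y′ u′ v′
  SameColour-resp x≈ y≈ u≈ v≈ xyuv =
    ≈±⇒SameColour (≈±-resp (\\-cong₂ x≈ y≈) (\\-cong₂ u≈ v≈) (SameColour⇒≈± xyuv))

  Adj-resp : ∀ {x x′ y y′} → x ≈ x′ → y ≈ y′ → Adj x y → Adj x′ y′
  Adj-resp x≈x′ y≈y′ (s , s∈S , y≈xs) = s , s∈S , trans (sym y≈y′) (trans y≈xs (∙-congʳ x≈x′))

  Adj-ε : ∀ {s} → S s → Adj ε s
  Adj-ε {s} s∈S = s , s∈S , sym (identityˡ s)

  Adj-∙ : ∀ a {s} → S s → Adj a (a ∙ s)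
  Adj-∙ a {s} s∈S = s , s∈S , refl

  module _ (A : Automorphism) where
    to-cong : ∀ {x y} → x ≈ y → to A x ≈ to A y
    to-cong = Inverse.to-cong (bij A)

    from-cong : ∀ {x y} → x ≈ y → from A x ≈ from A y
    from-cong = Inverse.from-cong (bij A)

    to-from : ∀ x → to A (from A x) ≈ x
    to-from = Inverse.strictlyInverseˡ (bij A)

    from-to : ∀ x → from A (to A x) ≈ x
    from-to = Inverse.strictlyInverseʳ (bij A)

    to-injective : ∀ {x y} → to A x ≈ to A y → x ≈ y
    to-injective = Injection.injective (Inverse⇒Injection (bij A))

    to-Adj : ∀ {x y} → Adj x y → Adj (to A x) (to A y)
    to-Adj = Equivalence.to (adj A _ _)

    from-Adj : ∀ {x y} → Adj x y → Adj (from A x) (from A y)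
    from-Adj {x} {y} xy = Equivalence.from (adj A _ _) (Adj-resp (sym (to-from x)) (sym (to-from y)) xy)

  translation : Carrier → Automorphism
  translation a = record
    { bij = record
      { to        = a ∙_
      ; from      = a \\_
      ; to-cong   = ∙-congˡ
      ; from-cong = ∙-congˡ
      ; inverse   = (λ y≈a\\x → trans (∙-congˡ y≈a\\x) (\\-leftDividesˡ a _))
                  , (λ y≈ax → trans (∙-congˡ y≈ax) (\\-leftDividesʳ a _))
      }
    ; adj = λ x y → mk⇔
      (λ (s , s∈S , y≈xs) → s , s∈S , trans (∙-congˡ y≈xs) (sym (assoc a x s)))
      (λ (s , s∈S , ay≈axs) → s , s∈S , ∙-cancelˡ a _ _ (trans ay≈axs (assoc a x s)))
    }

  infixr 9 _∘ᵃ_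
  _∘ᵃ_ : Automorphism → Automorphism → Automorphism
  A ∘ᵃ B = record
    { bij = Composition.inverse (bij B) (bij A)
    ; adj = λ x y → adj A (to B x) (to B y) Composition.⇔-∘ adj B x y
    }

  infix 10 _⁻¹ᵃ
  _⁻¹ᵃ : Automorphism → Automorphism
  A ⁻¹ᵃ = record
    { bij = Symmetry.inverse (bij A)
    ; adj = λ x y → mk⇔ (from-Adj A) (λ xy → Adj-resp (to-from A x) (to-from A y) (to-Adj A xy))
    }

  conjugate : Automorphism → Automorphism → Automorphism
  conjugate A B = A ∘ᵃ B ∘ᵃ A ⁻¹ᵃ

  Trivial-conjugate : ∀ A B → Trivial B → Trivial (conjugate A B)
  Trivial-conjugate A B B-trivial x = trans (to-cong A (B-trivial _)) (to-from A x)

  conjugate-Trivial : ∀ A B → Trivial (conjugate A B) → Trivial B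
  conjugate-Trivial A B ABA⁻¹-trivial x = begin
    to B x                                ≈⟨ to-cong B (from-to A x) ⟨
    to B (from A (to A x))                ≈⟨ from-to A _ ⟨
    from A (to (conjugate A B) (to A x))  ≈⟨ from-cong A (ABA⁻¹-trivial (to A x)) ⟩
    from A (to A x)                       ≈⟨ from-to A x ⟩
    x                                     ∎

  translation-colourPreserving : ∀ a → ColourPreserving (translation a)
  translation-colourPreserving a x y _ = inj₁ (sym (\\-invariant a x y))

  ∘-colourPreserving : ∀ {A B} → ColourPreserving A → ColourPreserving B →
                       ColourPreserving (A ∘ᵃ B)
  ∘-colourPreserving {A} {B} A-pres B-pres x y xy =
    SameColour-trans (B-pres x y xy) (A-pres _ _ (to-Adj B xy))

  ⁻¹-colourPreserving : ∀ {A} → ColourPreserving A → ColourPreserving (A ⁻¹ᵃ)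
  ⁻¹-colourPreserving {A} A-pres x y xy = SameColour-sym
    (SameColour-resp refl refl (to-from A x) (to-from A y) (A-pres _ _ (from-Adj A xy)))

  colourPreserving⇒colourPermuting : ∀ {A} → ColourPreserving A → ColourPermuting A
  colourPreserving⇒colourPermuting A-pres x y u v xy uv xyuv =
    SameColour-trans (SameColour-sym (A-pres x y xy)) (SameColour-trans xyuv (A-pres u v uv))

  ∘-colourPermuting : ∀ {A B} → ColourPermuting A → ColourPermuting B →
                      ColourPermuting (A ∘ᵃ B)
  ∘-colourPermuting {A} {B} A-perm B-perm x y u v xy uv xyuv =
    A-perm _ _ _ _ (to-Adj B xy) (to-Adj B uv) (B-perm x y u v xy uv xyuv)

  -- A⁻¹ sends the edge {x, y} to an edge e, and A sends the two edges e and B e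
  -- to edges of a common colour.
  conjugate-colourPreserving : ∀ {A B} → ColourPermuting A → ColourPreserving B →
                               ColourPreserving (conjugate A B)
  conjugate-colourPreserving {A} {B} A-perm B-pres x y xy =
    SameColour-resp (to-from A x) (to-from A y) refl refl
      (A-perm _ _ _ _ e (to-Adj B e) (B-pres _ _ e))
    where
    e : Adj (from A x) (from A y)
    e = from-Adj A xy

  stabiliser-≈± : ∀ ψ → ColourPreserving ψ → to ψ ε ≈ ε → ∀ {t} → S t → to ψ t ≈± t
  stabiliser-≈± ψ ψ-pres ψε≈ε {t} t∈S = ≈±-sym
    (≈±-resp (\\-identityˡ t refl) (\\-identityˡ _ ψε≈ε) (SameColour⇒≈± (ψ-pres ε t (Adj-ε t∈S))))

  S*-rigid : ∀ ψ₁ ψ₂ {t} → S* t → ColourPreserving ψ₁ → ColourPreserving ψ₂ →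
             to ψ₁ ε ≈ ε → to ψ₂ ε ≈ ε → to ψ₁ t ≈ to ψ₂ t → ∀ x → to ψ₁ x ≈ to ψ₂ x
  S*-rigid ψ₁ ψ₂ {t} (_ , t-rigid) ψ₁-pres ψ₂-pres ψ₁ε≈ε ψ₂ε≈ε ψ₁t≈ψ₂t x =
    trans (sym (to-from ψ₂ _)) (to-cong ψ₂ (ψ₂⁻¹ψ₁-trivial x))
    where
    ψ₂⁻¹ψ₁-trivial : Trivial (ψ₂ ⁻¹ᵃ ∘ᵃ ψ₁)
    ψ₂⁻¹ψ₁-trivial = t-rigid (ψ₂ ⁻¹ᵃ ∘ᵃ ψ₁)
      (∘-colourPreserving {ψ₂ ⁻¹ᵃ} {ψ₁} (⁻¹-colourPreserving {ψ₂} ψ₂-pres) ψ₁-pres)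
      (trans (from-cong ψ₂ (trans ψ₁ε≈ε (sym ψ₂ε≈ε))) (from-to ψ₂ ε))
      (trans (from-cong ψ₂ ψ₁t≈ψ₂t) (from-to ψ₂ t))

  -- The stabiliser of 1 in the colour-preserving group has at most two elements,
  -- told apart by their value t or t⁻¹ at t ∈ S*, so it is centralised by anything
  -- normalising it.
  S*-centralises-stabiliser : ∀ f τ {t} → S* t → ColourPermuting f → to f ε ≈ ε →
    ColourPreserving τ → to τ ε ≈ ε → ∀ x → to (conjugate f τ) x ≈ to τ x
  S*-centralises-stabiliser f τ {t} t∈S*@(t∈S , t-rigid) f-perm fε≈ε τ-pres τε≈ε =
    compare (stabiliser-≈± τ τ-pres τε≈ε t∈S) (stabiliser-≈± μ μ-pres με≈ε t∈S)
    where
    μ : Automorphism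
    μ = conjugate f τ

    μ-pres : ColourPreserving μ
    μ-pres = conjugate-colourPreserving {f} {τ} f-perm τ-pres

    με≈ε : to μ ε ≈ ε
    με≈ε = trans (to-cong f (trans (to-cong τ F⁻ε≈ε) τε≈ε)) fε≈ε
      where
      F⁻ε≈ε : from f ε ≈ ε
      F⁻ε≈ε = trans (from-cong f (sym fε≈ε)) (from-to f ε)

    agree : to μ t ≈ to τ t → ∀ x → to μ x ≈ to τ x
    agree = S*-rigid μ τ t∈S* μ-pres τ-pres με≈ε τε≈ε

    compare : to τ t ≈± t → to μ t ≈± t → ∀ x → to μ x ≈ to τ x
    compare (inj₁ τt≈t)   (inj₁ μt≈t)   = agree (trans μt≈t (sym τt≈t))
    compare (inj₂ τt≈t⁻¹) (inj₂ μt≈t⁻¹) = agree (trans μt≈t⁻¹ (sym τt≈t⁻¹))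
    compare (inj₁ τt≈t)   (inj₂ _)      x = trans (Trivial-conjugate f τ τ-trivial x) (sym (τ-trivial x))
      where
      τ-trivial : Trivial τ
      τ-trivial = t-rigid τ τ-pres τε≈ε τt≈t
    compare (inj₂ _)      (inj₁ μt≈t)   x = trans (μ-trivial x) (sym (conjugate-Trivial f τ μ-trivial x))
      where
      μ-trivial : Trivial μ
      μ-trivial = t-rigid μ μ-pres με≈ε μt≈t

  module Normalised (inverseClosed : InverseClosed) (S*-generates : Generates G S*)
                    (f : Automorphism) (f-perm : ColourPermuting f) (fε≈ε : to f ε ≈ ε) where
    F F⁻ : Carrier → Carrier
    F  = to f
    F⁻ = from f

    F⁻ε≈ε : F⁻ ε ≈ ε
    F⁻ε≈ε = trans (from-cong f (sym fε≈ε)) (from-to f ε)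

    ≈±-image : ∀ {x y u v} → Adj x y → Adj u v → x \\ y ≈± u \\ v → F x \\ F y ≈± F u \\ F v
    ≈±-image xy uv xyuv = SameColour⇒≈± (f-perm _ _ _ _ xy uv (≈±⇒SameColour xyuv))

    F-≈± : ∀ {s r} → S s → S r → s ≈± r → F s ≈± F r
    F-≈± s∈S r∈S s≈±r = ≈±-resp (\\-identityˡ _ fε≈ε) (\\-identityˡ _ fε≈ε)
      (≈±-image (Adj-ε s∈S) (Adj-ε r∈S)
        (≈±-resp (sym (\\-identityˡ _ refl)) (sym (\\-identityˡ _ refl)) s≈±r))

    edge-label : ∀ a {s} → S s → F a \\ F (a ∙ s) ≈± F s
    edge-label a s∈S = ≈±-resp refl (\\-identityˡ _ fε≈ε)
      (≈±-image (Adj-∙ a s∈S) (Adj-ε s∈S)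
        (inj₁ (trans (\\-leftDividesʳ a _) (sym (\\-identityˡ _ refl)))))

    involution-preserved : ∃ S* → ∀ {q} → S q → q ≈ q ⁻¹ → F q ≈ F q ⁻¹
    involution-preserved (t , t∈S*) {q} q∈S q≈q⁻¹ = begin
      F q                ≈⟨ to-cong f τq≈q ⟨
      F (to τ q)         ≈⟨ to-cong f (to-cong τ (from-to f q)) ⟨
      to μ (F q)         ≈⟨ S*-centralises-stabiliser f τ t∈S* f-perm fε≈ε τ-pres τε≈ε (F q) ⟩
      to τ (F q)         ≈⟨ τw≈w⁻¹ ⟩
      F q ⁻¹             ∎
      where
      w : Carrier
      w = F q

      τ μ : Automorphism
      τ = translation (w ⁻¹) ∘ᵃ conjugate f (translation q)
      μ = conjugate f τ

      τ-pres : ColourPreserving τ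
      τ-pres = ∘-colourPreserving {translation (w ⁻¹)} {conjugate f (translation q)}
        (translation-colourPreserving _)
        (conjugate-colourPreserving {f} {translation q} f-perm (translation-colourPreserving q))

      τε≈ε : to τ ε ≈ ε
      τε≈ε = trans (∙-congˡ (to-cong f (trans (∙-congˡ F⁻ε≈ε) (identityʳ q)))) (inverseˡ w)

      τq≈q : to τ q ≈ q
      τq≈q with stabiliser-≈± τ τ-pres τε≈ε q∈S
      ... | inj₁ τq≈q   = τq≈q
      ... | inj₂ τq≈q⁻¹ = trans τq≈q⁻¹ (sym q≈q⁻¹)

      τw≈w⁻¹ : to τ w ≈ w ⁻¹
      τw≈w⁻¹ = begin
        w ⁻¹ ∙ F (q ∙ F⁻ (F q)) ≈⟨ ∙-congˡ (to-cong f (∙-congˡ (from-to f q))) ⟩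
        w ⁻¹ ∙ F (q ∙ q)        ≈⟨ ∙-congˡ (to-cong f (trans (∙-congˡ q≈q⁻¹) (inverseʳ q))) ⟩
        w ⁻¹ ∙ F ε              ≈⟨ ∙-congˡ fε≈ε ⟩
        w ⁻¹ ∙ ε                ≈⟨ identityʳ _ ⟩
        w ⁻¹                    ∎

    inverse-preserved : ∀ {q} → S q → F (q ⁻¹) ≈ F q ⁻¹
    inverse-preserved {q} q∈S
      with F-≈± q∈S (inverseClosed q q∈S) (inj₂ (sym (⁻¹-involutive q)))
    ... | inj₂ Fq≈Fq⁻¹⁻¹ = trans (sym (⁻¹-involutive _)) (⁻¹-cong (sym Fq≈Fq⁻¹⁻¹))
    ... | inj₁ Fq≈Fq⁻¹ with Generated⇒inhabited⊎≈ε G (S*-generates q)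
    ...   | inj₁ S*-inhabited =
      trans (sym Fq≈Fq⁻¹) (involution-preserved S*-inhabited q∈S (to-injective f Fq≈Fq⁻¹))
    ...   | inj₂ q≈ε = trans (sym Fq≈Fq⁻¹) (trans Fq≈ε (sym (trans (⁻¹-cong Fq≈ε) ε⁻¹≈ε)))
      where
      Fq≈ε : F q ≈ ε
      Fq≈ε = trans (to-cong f q≈ε) fε≈ε

    F-reflects-≈± : ∀ {s r} → S s → S r → F s ≈± F r → s ≈± r
    F-reflects-≈± s∈S r∈S (inj₁ Fs≈Fr)   = inj₁ (to-injective f Fs≈Fr)
    F-reflects-≈± s∈S r∈S (inj₂ Fs≈Fr⁻¹) =
      inj₂ (to-injective f (trans Fs≈Fr⁻¹ (sym (inverse-preserved r∈S))))

    ⁻¹-colourPermuting : ColourPermuting (f ⁻¹ᵃ)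
    ⁻¹-colourPermuting x y u v xy uv xyuv with from-Adj f xy | from-Adj f uv
    ... | s , s∈S , y′≈x′s | r , r∈S , v′≈u′r =
      ≈±⇒SameColour (≈±-resp (sym (label y′≈x′s)) (sym (label v′≈u′r))
        (F-reflects-≈± s∈S r∈S (≈±-trans (≈±-sym (preimage-label s∈S y′≈x′s))
          (≈±-trans (SameColour⇒≈± xyuv) (preimage-label r∈S v′≈u′r)))))
      where
      label : ∀ {a b s} → b ≈ a ∙ s → a \\ b ≈ s
      label {a} b≈as = trans (∙-congˡ b≈as) (\\-leftDividesʳ a _)

      preimage-label : ∀ {a b s} → S s → F⁻ b ≈ F⁻ a ∙ s → a \\ b ≈± F s
      preimage-label {a} {b} s∈S b′≈a′s = ≈±-resp
        (\\-cong₂ (to-from f a) (trans (to-cong f (sym b′≈a′s)) (to-from f b)))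
        refl (edge-label (F⁻ a) s∈S)

    Multiplicative : Pred Carrier (c ⊔ ℓ)
    Multiplicative g = ∀ x → F (g ∙ x) ≈ F g ∙ F x

    Multiplicative-resp : Multiplicative Respects _≈_
    Multiplicative-resp g≈h g-mult x =
      trans (to-cong f (∙-congʳ (sym g≈h))) (trans (g-mult x) (∙-congʳ (to-cong f g≈h)))

    Multiplicative-ε : Multiplicative ε
    Multiplicative-ε x = trans (to-cong f (identityˡ x)) (sym (trans (∙-congʳ fε≈ε) (identityˡ _)))

    Multiplicative-∙ : ∀ {g h} → Multiplicative g → Multiplicative h → Multiplicative (g ∙ h)
    Multiplicative-∙ {g} {h} g-mult h-mult x = begin
      F (g ∙ h ∙ x)       ≈⟨ to-cong f (assoc g h x) ⟩
      F (g ∙ (h ∙ x))     ≈⟨ g-mult _ ⟩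
      F g ∙ F (h ∙ x)     ≈⟨ ∙-congˡ (h-mult x) ⟩
      F g ∙ (F h ∙ F x)   ≈⟨ assoc _ _ _ ⟨
      F g ∙ F h ∙ F x     ≈⟨ ∙-congʳ (g-mult h) ⟨
      F (g ∙ h) ∙ F x     ∎

    Multiplicative-⁻¹ : ∀ {g} → Multiplicative g → Multiplicative (g ⁻¹)
    Multiplicative-⁻¹ {g} g-mult x = trans (F-g⁻¹∙ x) (∙-congʳ (sym F-g⁻¹))
      where
      F-g⁻¹∙ : ∀ y → F (g ⁻¹ ∙ y) ≈ F g ⁻¹ ∙ F y
      F-g⁻¹∙ y = y≈x\\z _ _ _ (trans (sym (g-mult _)) (to-cong f (\\-leftDividesˡ g y)))

      F-g⁻¹ : F (g ⁻¹) ≈ F g ⁻¹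
      F-g⁻¹ = trans (to-cong f (sym (identityʳ _)))
        (trans (F-g⁻¹∙ ε) (trans (∙-congˡ fε≈ε) (identityʳ _)))

    S*⊆Multiplicative : S* ⊆ Multiplicative
    S*⊆Multiplicative {s} (s∈S , s-rigid) y = sym (begin
      F s ∙ F y                        ≈⟨ ∙-congˡ (to-cong f (\\-leftDividesʳ s y)) ⟨
      F s ∙ F (s ⁻¹ ∙ (s ∙ y))         ≈⟨ to-from f _ ⟨
      F (to σ (s ∙ y))                 ≈⟨ to-cong f (σ-trivial (s ∙ y)) ⟩
      F (s ∙ y)                        ∎)
      where
      σ : Automorphism
      σ = conjugate (f ⁻¹ᵃ) (translation (F s)) ∘ᵃ translation (s ⁻¹)

      σ-pres : ColourPreserving σ
      σ-pres = ∘-colourPreserving {conjugate (f ⁻¹ᵃ) (translation (F s))} {translation (s ⁻¹)}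
        (conjugate-colourPreserving {f ⁻¹ᵃ} {translation (F s)} ⁻¹-colourPermuting
          (translation-colourPreserving (F s)))
        (translation-colourPreserving (s ⁻¹))

      σε≈ε : to σ ε ≈ ε
      σε≈ε = trans (from-cong f (begin
        F s ∙ F (s ⁻¹ ∙ ε)   ≈⟨ ∙-congˡ (to-cong f (identityʳ _)) ⟩
        F s ∙ F (s ⁻¹)       ≈⟨ ∙-congˡ (inverse-preserved s∈S) ⟩
        F s ∙ F s ⁻¹         ≈⟨ inverseʳ _ ⟩
        ε                    ∎)) F⁻ε≈ε

      σs≈s : to σ s ≈ s
      σs≈s = trans (from-cong f (begin
        F s ∙ F (s ⁻¹ ∙ s)   ≈⟨ ∙-congˡ (to-cong f (inverseˡ s)) ⟩
        F s ∙ F ε            ≈⟨ ∙-congˡ fε≈ε ⟩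
        F s ∙ ε              ≈⟨ identityʳ _ ⟩
        F s                  ∎)) (from-to f s)

      σ-trivial : Trivial σ
      σ-trivial = s-rigid σ σ-pres σε≈ε σs≈s

    homomorphism : ∀ x y → F (x ∙ y) ≈ F x ∙ F y
    homomorphism x = Generated⊆ G Multiplicative-resp Multiplicative-ε
      Multiplicative-⁻¹ Multiplicative-∙ S*⊆Multiplicative (S*-generates x)

    isGroupAutomorphism : IsGroupAutomorphism F
    isGroupAutomorphism = record
      { isGroupMonomorphism = record
        { isGroupHomomorphism = record
          { isMonoidHomomorphism = record
            { isMagmaHomomorphism = record
              { isRelHomomorphism = record { cong = to-cong f }
              ; homo = homomorphism
              }
            ; ε-homo = fε≈ε
            }
          ; ⁻¹-homo = λ x → inverseʳ-unique (F x) (F (x ⁻¹))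
              (trans (sym (homomorphism x (x ⁻¹))) (trans (to-cong f (inverseʳ x)) fε≈ε))
          }
        ; injective = to-injective f
        }
      ; surjective = Surjection.surjective (Inverse⇒Surjection (bij f))
      }

  colourPermuting⇒affine : InverseClosed → Generates G S* →
                           ∀ φ → ColourPermuting φ → Affine (to φ)
  colourPermuting⇒affine inverseClosed S*-generates φ φ-perm =
    F , F⁻ φ1 , isGroupAutomorphism , φ-affine
    where
    φ1 : Carrier
    φ1 = to φ ε

    f : Automorphism
    f = translation (φ1 ⁻¹) ∘ᵃ φ

    f-perm : ColourPermuting f
    f-perm = ∘-colourPermuting {translation (φ1 ⁻¹)} {φ}
      (colourPreserving⇒colourPermuting {translation (φ1 ⁻¹)} (translation-colourPreserving _)) φ-perm

    open Normalised inverseClosed S*-generates f f-perm (inverseˡ φ1)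

    φ-affine : ∀ x → to φ x ≈ F (F⁻ φ1 ∙ x)
    φ-affine x = sym (begin
      F (F⁻ φ1 ∙ x)         ≈⟨ homomorphism _ x ⟩
      F (F⁻ φ1) ∙ F x       ≈⟨ ∙-congʳ (to-from f φ1) ⟩
      φ1 ∙ (φ1 \\ to φ x)   ≈⟨ \\-leftDividesˡ φ1 _ ⟩
      to φ x                ∎)

lemma4p4 : {c ℓ p : Level} (G : Group c ℓ) (S : Pred (Group.Carrier G) p) →
    S Respects (Group._≈_ G) → Cayley.InverseClosed G S →
    Generates G (Cayley.S* G S) → Cayley.StronglyCCA G S
lemma4p4 G S _ inverseClosed S*-generates =
  CayleyGraph.colourPermuting⇒affine G S inverseClosed S*-generates
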